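{- Every finite chordal trigraph admits a tree representation.
   Context: A trigraph is a triple $(V, E_B, E_R)$ where $E_B$ and $E_R$ are disjoint subsets of $\binom{V}{2}$, the black and red edges. For $u,v\in V$, the adjacency type of $uv$ is "black" if $uv\in E_B$, "red" if $uv \in E_R$, and "non-edge" otherwise. The total graph $\mathcal T(H')$ of a trigraph $H'$ is the graph $(V, E_B\cup E_R)$; $H'$ is chordal if its total graph is chordal (has no induced cycle of length at least 4). In a rooted tree, every node is its own ancestor and descendant; $\mathrm{ancestors}(v)$ and $\mathrm{desc}(v)$ denote the sets of ancestors and descendants of $v$, and $\mathrm{parent}(v)$ its parent. A tree representation of a chordal trigraph $H'$ with total graph $H$ is a rooted tree $T$ on vertex set $V(H)$ such that: (1) for every $v\in V(H)$, $N_H(v) \cap \mathrm{ancestors}(v)$ is a clique in $H$; (2) for every non-root vertex $v$, $N_H(v) \subseteq \mathrm{desc}(v) \cup (\mathrm{ancestors}(v) \cap N_H[\mathrm{parent}(v)])$; (3) if $u$ and $v$ are siblings in $T$ (distinct with the same parent), then they have a common ancestor $x$ such that $ux$ and $vx$ have distinct adjacency types in $H'$. -}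

module Defs where

open import Data.Nat using (ℕ; suc; _+_; _%_)
open import Data.Fin using (Fin; toℕ)
open import Data.Maybe using (Maybe; just; nothing)
open import Data.Product using (Σ; _×_; ∃-syntax)
open import Data.Sum using (_⊎_)
open import Relation.Nullary using (¬_)
open import Relation.Binary.PropositionalEquality using (_≡_; _≢_)
open import Function.Definitions using (Injective)

data AdjType : Set where
  black red nonEdge : AdjType

-- A finite trigraph on vertex set Fin n: every unordered pair {u,v} (u ≠ v)
-- gets exactly one adjacency type (black / red / non-edge), so E_B and E_R
-- are disjoint sets of 2-subsets.  The diagonal carries no information and
-- is fixed to nonEdge.
record Trigraph (n : ℕ) : Set where
  field
    type   : Fin n → Fin n → AdjType
    sym    : ∀ u v → type u v ≡ type v u
    irrefl : ∀ v → type v v ≡ nonEdge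
open Trigraph public

-- Edge relation of the total graph T(H') = (V, E_B ∪ E_R).
Edge : ∀ {n} → Trigraph n → Fin n → Fin n → Set
Edge H u v = type H u v ≢ nonEdge

Consecutive : ∀ {m} → Fin (suc m) → Fin (suc m) → Set
Consecutive {m} i j = toℕ j ≡ (toℕ i + 1) % suc m ⊎ toℕ i ≡ (toℕ j + 1) % suc m

-- An induced cycle of length k = 4 + m (≥ 4) in the total graph:
-- k distinct vertices c 0, …, c (k-1), where c i c j is an edge iff i, j are
-- consecutive modulo k.
record InducedCycle {n} (H : Trigraph n) (m : ℕ) : Set where
  field
    c       : Fin (suc (suc (suc (suc m)))) → Fin n
    inj     : Injective _≡_ _≡_ c
    edges   : ∀ i j → Consecutive i j → Edge H (c i) (c j)
    nonEdges : ∀ i j → i ≢ j → ¬ Consecutive i j → ¬ Edge H (c i) (c j)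

Chordal : ∀ {n} → Trigraph n → Set
Chordal H = ∀ m → ¬ InducedCycle H m

data Ancestor {n} (p : Fin n → Maybe (Fin n)) : Fin n → Fin n → Set where
  here : ∀ {v} → Ancestor p v v
  up   : ∀ {u v w} → p v ≡ just w → Ancestor p u w → Ancestor p u v

-- p is a rooted tree on Fin n: all roots (vertices without parent) coincide,
-- and every vertex has a root among its ancestors (so the parent relation
-- is acyclic and connected).  For n = 0 this is the empty tree.
record IsRootedTree {n} (p : Fin n → Maybe (Fin n)) : Set where
  field
    rootUnique : ∀ r s → p r ≡ nothing → p s ≡ nothing → r ≡ s
    reachRoot  : ∀ v → Σ (Fin n) λ r → p r ≡ nothing × Ancestor p r v

record TreeRepresentation {n} (H : Trigraph n) : Set where
  field
    parent : Fin n → Maybe (Fin n)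
    isTree : IsRootedTree parent
    cond1 : ∀ v a b → Ancestor parent a v → Ancestor parent b v →
            Edge H v a → Edge H v b → a ≢ b → Edge H a b
    cond2 : ∀ v q → parent v ≡ just q → ∀ w → Edge H v w →
            Ancestor parent v w ⊎ (Ancestor parent w v × (w ≡ q ⊎ Edge H q w))
    cond3 : ∀ u v q → u ≢ v → parent u ≡ just q → parent v ≡ just q →
            Σ (Fin n) λ x → Ancestor parent x u × Ancestor parent x v ×
                             type H u x ≢ type H v x

{-# OPTIONS --safe #-}
-- Build the tree top-down. At a node whose ancestors (the node included) form the list P, the vertices S
-- still to be placed below it are sorted by a signature: the adjacency types towards P of a canonical
-- representative of their connected component in H[S], namely a vertex of the component adjacent to every
-- vertex of P that has a neighbour in the component. Such a vertex exists because the vertices of P with a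
-- neighbour in S form a clique, and chordality lets one move along induced paths without losing neighbours
-- (otherwise an induced cycle of length ≥ 4 appears). Each signature class becomes the subtree of one child,
-- a representative with that signature: siblings then differ in adjacency type towards a common ancestor,
-- components never split (condition (2)), and the clique property of P gives condition (1).

module Submission where

open import Defs hiding (sym)
open import Data.Fin using (Fin; toℕ)
open import Data.Fin.Properties using (any?; toℕ<n; toℕ-injective) renaming (_≟_ to _≟ᶠ_)
open import Data.List using (List; []; _∷_; map; filter; find; length; allFin; head; drop)
open import Data.List.Membership.Propositional using (_∈_; lose) renaming (find to find-∈)
open import Data.List.Membership.Propositional.Properties using (∈-allFin)
open import Data.List.Properties
  using (length-filter; filter-some; length-tabulate; ∷-injectiveˡ; ∷-injectiveʳ; map-cong-local)
  renaming (≡-dec to ≡-decᴸ)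
open import Data.List.Relation.Unary.All as All using (All; all?)
open import Data.List.Relation.Unary.All.Properties using (¬All⇒Any¬)
open import Data.List.Relation.Unary.Any using (here; there)
open import Data.Maybe using (Maybe; just; nothing; maybe′)
open import Data.Maybe.Properties using (just-injective) renaming (≡-dec to ≡-decᴹ)
open import Data.Nat using (ℕ; zero; suc; _+_; _%_; _≤_; _<_; z≤n; s≤s; _≟_)
open import Data.Nat.DivMod using (m<n⇒m%n≡m; n%n≡0)
open import Data.Nat.Properties
open import Data.Product using (_×_; _,_; proj₁; proj₂; ∃-syntax)
open import Data.Sum using (_⊎_; inj₁; inj₂; swap)
open import Data.Unit using (⊤; tt)
open import Function using (id; _∘_)
open import Level using (0ℓ)
open import Relation.Binary using (Rel; DecidableEquality; tri<; tri≈; tri>) renaming (Decidable to Decidable₂)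
open import Relation.Binary.Construct.Closure.ReflexiveTransitive using (Star; ε; _◅_; _◅◅_; reverse)
open import Relation.Binary.PropositionalEquality using (_≡_; _≢_; refl; cong; subst; subst₂; sym; trans)
open import Relation.Nullary using (¬_; yes; no; contradiction)
open import Relation.Nullary.Decidable using (_×-dec_; _⊎-dec_; _→-dec_; ¬?; map′; decidable-stable)
open import Relation.Unary using (Pred; Decidable; _⊆_; _≐_)

module _ {a p q} {A : Set a} {P : Pred A p} {Q : Pred A q}
         (P? : Decidable P) (Q? : Decidable Q) where

  length-filter-⊆ : Q ⊆ P → ∀ xs → length (filter Q? xs) ≤ length (filter P? xs)
  length-filter-⊆ Q⊆P [] = z≤n
  length-filter-⊆ Q⊆P (x ∷ xs) with P? x | Q? x
  ... | yes _ | yes _ = s≤s (length-filter-⊆ Q⊆P xs)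
  ... | yes _ | no  _ = m≤n⇒m≤1+n (length-filter-⊆ Q⊆P xs)
  ... | no ¬p | yes q = contradiction (Q⊆P q) ¬p
  ... | no  _ | no  _ = length-filter-⊆ Q⊆P xs

  length-filter-⊂ : Q ⊆ P → ∀ {x xs} → x ∈ xs → P x → ¬ Q x →
                    length (filter Q? xs) < length (filter P? xs)
  length-filter-⊂ Q⊆P {xs = y ∷ xs} x∈ px ¬qx with P? y | Q? y | x∈
  ... | no ¬p | yes q | _         = contradiction (Q⊆P q) ¬p
  ... | yes _ | yes q | here refl = contradiction q ¬qx
  ... | yes _ | no  _ | here refl = s≤s (length-filter-⊆ Q⊆P xs)
  ... | no ¬p | no  _ | here refl = contradiction px ¬p
  ... | yes _ | yes _ | there x∈xs = s≤s (length-filter-⊂ Q⊆P x∈xs px ¬qx)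
  ... | yes _ | no  _ | there x∈xs = m≤n⇒m≤1+n (length-filter-⊂ Q⊆P x∈xs px ¬qx)
  ... | no  _ | no  _ | there x∈xs = length-filter-⊂ Q⊆P x∈xs px ¬qx

  find-≐ : P ≐ Q → ∀ xs → find P? xs ≡ find Q? xs
  find-≐ P≐Q [] = refl
  find-≐ P≐Q (x ∷ xs) with P? x | Q? x
  ... | yes _ | yes _ = refl
  ... | yes p | no ¬q = contradiction (proj₁ P≐Q p) ¬q
  ... | no ¬p | yes q = contradiction (proj₂ P≐Q q) ¬p
  ... | no  _ | no  _ = find-≐ P≐Q xs

module _ {a p} {A : Set a} {P : Pred A p} (P? : Decidable P) where

  find-sound : ∀ xs {x} → find P? xs ≡ just x → P x
  find-sound (y ∷ xs) eq with P? y
  ... | yes py = subst P (just-injective eq) py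
  ... | no  _  = find-sound xs eq

  find-complete : ∀ {x xs} → x ∈ xs → P x → ∃[ y ] find P? xs ≡ just y
  find-complete {xs = y ∷ xs} x∈ px with P? y | x∈
  ... | yes _ | _          = y , refl
  ... | no ¬p | here refl  = contradiction px ¬p
  ... | no  _ | there x∈xs = find-complete x∈xs px

length-filter-allFin : ∀ {p n} {P : Pred (Fin n) p} (P? : Decidable P) → length (filter P? (allFin n)) ≤ n
length-filter-allFin {n = n} P? = ≤-trans (length-filter P? (allFin n)) (≤-reflexive (length-tabulate id))

map-≡-∈ : ∀ {a b} {A : Set a} {B : Set b} {f g : A → B} {x} xs →
          map f xs ≡ map g xs → x ∈ xs → f x ≡ g x
map-≡-∈ (y ∷ xs) eq (here refl)  = ∷-injectiveˡ eq
map-≡-∈ (y ∷ xs) eq (there x∈xs) = map-≡-∈ xs (∷-injectiveʳ eq) x∈xs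

greatest : ∀ {p} {P : Pred ℕ p} → Decidable P → ∀ k → P 0 →
           ∃[ i ] i ≤ k × P i × (∀ {j} → i < j → j ≤ k → ¬ P j)
greatest P? zero p0 = 0 , z≤n , p0 , λ 0<j j≤0 → contradiction (<-≤-trans 0<j j≤0) (n≮n 0)
greatest {P = P} P? (suc k) p0 with P? (suc k)
... | yes pk = suc k , ≤-refl , pk , λ k<j j≤k → contradiction (<-≤-trans k<j j≤k) (n≮n (suc k))
... | no ¬pk with greatest P? k p0
...   | i , i≤k , pi , beyond = i , m≤n⇒m≤1+n i≤k , pi , beyond′
  where
    beyond′ : ∀ {j} → i < j → j ≤ suc k → ¬ P j
    beyond′ i<j j≤1+k with m≤n⇒m<n∨m≡n j≤1+k
    ... | inj₁ j<1+k = beyond i<j (≤-pred j<1+k)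
    ... | inj₂ refl  = ¬pk

module _ {n} {R : Rel (Fin n) 0ℓ} (R? : Decidable₂ R) where

  private
    Within : ℕ → Rel (Fin n) 0ℓ
    Within zero    x y = x ≡ y
    Within (suc k) x y = Within k x y ⊎ ∃[ u ] Within k x u × R u y

    within? : ∀ k → Decidable₂ (Within k)
    within? zero    x y = x ≟ᶠ y
    within? (suc k) x y = within? k x y ⊎-dec any? (λ u → within? k x u ×-dec R? u y)

    within⇒star : ∀ k {x y} → Within k x y → Star R x y
    within⇒star zero    refl = ε
    within⇒star (suc k) (inj₁ w) = within⇒star k w
    within⇒star (suc k) (inj₂ (u , w , r)) = within⇒star k w ◅◅ (r ◅ ε)

    within-refl : ∀ k {x} → Within k x x
    within-refl zero    = refl
    within-refl (suc k) = inj₁ (within-refl k)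

    size : ℕ → Fin n → ℕ
    size k x = length (filter (within? k x) (allFin n))

    Saturated : ℕ → Fin n → Set
    Saturated k x = ∀ {y} → Within (suc k) x y → Within k x y

    saturated-suc : ∀ {k x} → Saturated k x → Saturated (suc k) x
    saturated-suc sat (inj₁ w)           = w
    saturated-suc sat (inj₂ (u , w , r)) = inj₂ (u , sat w , r)

    saturated-or-large : ∀ k x → Saturated k x ⊎ k < size k x
    saturated-or-large zero x = inj₂ (filter-some (within? 0 x) (lose (∈-allFin x) refl))
    saturated-or-large (suc k) x with saturated-or-large k x
    ... | inj₁ sat = inj₁ (saturated-suc sat)
    ... | inj₂ k<size with any? (λ y → within? (suc k) x y ×-dec ¬? (within? k x y))
    ...   | yes (y , w , ¬w) = inj₂ (≤-<-trans k<size
                                 (length-filter-⊂ (within? (suc k) x) (within? k x) inj₁ (∈-allFin y) w ¬w))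
    ...   | no new = inj₁ (saturated-suc λ {y} w → decidable-stable (within? k x y) λ ¬w → new (y , w , ¬w))

    saturated : ∀ x → Saturated n x
    saturated x with saturated-or-large n x
    ... | inj₁ sat     = sat
    ... | inj₂ n<size = contradiction (length-filter-allFin (within? n x)) (<⇒≱ n<size)

    within-◅◅ : ∀ {x u y} → Within n x u → Star R u y → Within n x y
    within-◅◅ w ε        = w
    within-◅◅ w (r ◅ rs) = within-◅◅ (saturated _ (inj₂ (_ , w , r))) rs

  star? : Decidable₂ (Star R)
  star? x y = map′ (within⇒star n) (within-◅◅ (within-refl n)) (within? n x y)


_≟ᵗ_ : DecidableEquality AdjType
black   ≟ᵗ black   = yes refl
black   ≟ᵗ red     = no λ ()
black   ≟ᵗ nonEdge = no λ ()
red     ≟ᵗ black   = no λ ()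
red     ≟ᵗ red     = yes refl
red     ≟ᵗ nonEdge = no λ ()
nonEdge ≟ᵗ black   = no λ ()
nonEdge ≟ᵗ red     = no λ ()
nonEdge ≟ᵗ nonEdge = yes refl

_◂_ : ∀ {A : Set} → A → (ℕ → A) → ℕ → A
(a ◂ f) zero    = a
(a ◂ f) (suc i) = f i

next-index : ∀ K a → a ≤ K → (a + 1) % suc K ≡ suc a ⊎ a ≡ K × (a + 1) % suc K ≡ 0
next-index K a a≤K with m≤n⇒m<n∨m≡n a≤K
... | inj₁ a<K  = inj₁ (trans (cong (_% suc K) (+-comm a 1)) (m<n⇒m%n≡m (s≤s a<K)))
... | inj₂ refl = inj₂ (refl , trans (cong (_% suc K) (+-comm a 1)) (n%n≡0 (suc K)))

module _ {K : ℕ} {i j : Fin (suc K)} where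

  consecutive-suc : toℕ j ≡ suc (toℕ i) → Consecutive i j
  consecutive-suc eq with next-index K (toℕ i) (≤-pred (toℕ<n i))
  ... | inj₁ next      = inj₁ (trans eq (sym next))
  ... | inj₂ (i≡K , _) = contradiction (subst (_< suc K) (trans eq (cong suc i≡K)) (toℕ<n j)) (n≮n (suc K))

  consecutive-wrap : toℕ i ≡ 0 → toℕ j ≡ K → Consecutive i j
  consecutive-wrap i≡0 j≡K = inj₂ (trans i≡0 (sym (trans (cong (λ a → (a + 1) % suc K) j≡K)
                                                  (trans (cong (_% suc K) (+-comm K 1)) (n%n≡0 (suc K))))))

module _ {n : ℕ} (H : Trigraph n) where

  Edge-sym : ∀ {u v} → Edge H u v → Edge H v u
  Edge-sym {u} {v} e eq = e (trans (Trigraph.sym H u v) eq)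

  Edge-irrefl : ∀ {v} → ¬ Edge H v v
  Edge-irrefl {v} e = e (irrefl H v)

  Edge⇒≢ : ∀ {u v} → Edge H u v → u ≢ v
  Edge⇒≢ e refl = Edge-irrefl e

  edge? : Decidable₂ (Edge H)
  edge? u v = ¬? (type H u v ≟ᵗ nonEdge)

  record InducedPath (f : ℕ → Fin n) (k : ℕ) : Set where
    field
      distinct  : ∀ {i j} → i < j → j ≤ k → f i ≢ f j
      linked    : ∀ {i} → i < k → Edge H (f i) (f (suc i))
      chordless : ∀ {i j} → suc i < j → j ≤ k → ¬ Edge H (f i) (f j)

  single-induced : ∀ f → InducedPath f 0
  single-induced f = record
    { distinct  = λ { i<j z≤n → contradiction i<j λ () }
    ; linked    = λ ()
    ; chordless = λ { i<j z≤n → contradiction i<j λ () } }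

  drop-induced : ∀ {f} i {k} → InducedPath f (i + k) → InducedPath (λ t → f (i + t)) k
  drop-induced {f} i path = record
    { distinct  = λ s<t t≤k → distinct (+-monoʳ-< i s<t) (+-monoʳ-≤ i t≤k)
    ; linked    = λ {t} t<k → subst (Edge H (f (i + t))) (cong f (sym (+-suc i t)))
                                    (linked (+-monoʳ-< i t<k))
    ; chordless = λ {s} {t} s+1<t t≤k → chordless (subst (_< i + t) (+-suc i s) (+-monoʳ-< i s+1<t))
                                              (+-monoʳ-≤ i t≤k) }
    where open InducedPath path

  ◂-induced : ∀ {v f k} → InducedPath f k → Edge H v (f 0) →
              (∀ {t} → 0 < t → t ≤ k → ¬ Edge H v (f t)) → (∀ {t} → t ≤ k → v ≢ f t) →
              InducedPath (v ◂ f) (suc k)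
  ◂-induced {v} {f} path v~f0 v≁f v∉f = record
    { distinct  = λ { {zero} {suc t} _ t≤k → v∉f (≤-pred t≤k)
                    ; {suc s} {suc t} s<t t≤k → distinct (≤-pred s<t) (≤-pred t≤k) }
    ; linked    = λ { {zero} _ → v~f0 ; {suc i} i<k → linked (≤-pred i<k) }
    ; chordless = λ { {zero} {suc t} 1<t t≤k → v≁f (≤-pred 1<t) (≤-pred t≤k)
                    ; {suc s} {suc t} s+1<t t≤k → chordless (≤-pred s+1<t) (≤-pred t≤k) } }
    where open InducedPath path

  record InducedCycleSeq (m : ℕ) : Set where
    field
      vertex    : ℕ → Fin n
      distinct  : ∀ {i j} → i < j → j ≤ 3 + m → vertex i ≢ vertex j
      linked    : ∀ {i} → i < 3 + m → Edge H (vertex i) (vertex (suc i))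
      closed    : Edge H (vertex 0) (vertex (3 + m))
      chordless : ∀ {i j} → suc i < j → j ≤ 3 + m → 0 < i ⊎ j < 3 + m →
                  ¬ Edge H (vertex i) (vertex j)

  module _ {m} (cyc : InducedCycleSeq m) where
    open InducedCycleSeq cyc

    private
      K = 3 + m

      c : Fin (suc K) → Fin n
      c i = vertex (toℕ i)

      injective : ∀ {i j} → c i ≡ c j → i ≡ j
      injective {i} {j} eq with <-cmp (toℕ i) (toℕ j)
      ... | tri< i<j _ _ = contradiction eq (distinct i<j (≤-pred (toℕ<n j)))
      ... | tri≈ _ i≡j _ = toℕ-injective i≡j
      ... | tri> _ _ j<i = contradiction (sym eq) (distinct j<i (≤-pred (toℕ<n i)))

      forward-edge : ∀ i j → toℕ j ≡ (toℕ i + 1) % suc K → Edge H (c i) (c j)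
      forward-edge i j eq with next-index K (toℕ i) (≤-pred (toℕ<n i))
      ... | inj₁ next = subst (Edge H (c i)) (cong vertex (sym (trans eq next)))
                              (linked (subst (_≤ K) (trans eq next) (≤-pred (toℕ<n j))))
      ... | inj₂ (i≡K , wrap) = subst₂ (Edge H) (cong vertex (sym i≡K)) (cong vertex (sym (trans eq wrap)))
                                       (Edge-sym closed)

      edges : ∀ i j → Consecutive i j → Edge H (c i) (c j)
      edges i j (inj₁ eq) = forward-edge i j eq
      edges i j (inj₂ eq) = Edge-sym (forward-edge j i eq)

      forward-non-edge : ∀ i j → toℕ i < toℕ j → ¬ Consecutive i j → ¬ Edge H (c i) (c j)
      forward-non-edge i j i<j ¬cons =
        chordless (≤∧≢⇒< i<j λ eq → ¬cons (consecutive-suc (sym eq))) (≤-pred (toℕ<n j)) not-closing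
        where
          not-closing : 0 < toℕ i ⊎ toℕ j < K
          not-closing with toℕ i ≟ 0 | toℕ j ≟ K
          ... | no i≢0  | _       = inj₁ (n≢0⇒n>0 i≢0)
          ... | yes i≡0 | yes j≡K = contradiction (consecutive-wrap i≡0 j≡K) ¬cons
          ... | yes _   | no j≢K  = inj₂ (≤∧≢⇒< (≤-pred (toℕ<n j)) j≢K)

      non-edges : ∀ i j → i ≢ j → ¬ Consecutive i j → ¬ Edge H (c i) (c j)
      non-edges i j i≢j ¬cons with <-cmp (toℕ i) (toℕ j)
      ... | tri< i<j _ _ = forward-non-edge i j i<j ¬cons
      ... | tri≈ _ i≡j _ = contradiction (toℕ-injective i≡j) i≢j
      ... | tri> _ _ j<i = forward-non-edge j i j<i (¬cons ∘ swap) ∘ Edge-sym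

    toInducedCycle : InducedCycle H m
    toInducedCycle = record { c = c ; inj = injective ; edges = edges ; nonEdges = non-edges }

  close-induced : ∀ {z r m} → InducedPath r (2 + m) → (∀ {t} → t ≤ 2 + m → z ≢ r t) →
                  Edge H z (r 0) → Edge H z (r (2 + m)) →
                  (∀ {t} → 0 < t → t < 2 + m → ¬ Edge H z (r t)) → InducedCycleSeq m
  close-induced {z} {r} path z∉r z~first z~last z≁inner = record
    { vertex    = z ◂ r
    ; distinct  = λ { {zero} {suc t} _ t≤ → z∉r (≤-pred t≤)
                    ; {suc s} {suc t} s<t t≤ → distinct (≤-pred s<t) (≤-pred t≤) }
    ; linked    = λ { {zero} _ → z~first ; {suc i} i< → linked (≤-pred i<) }
    ; closed    = z~last
    ; chordless = λ { {zero} {suc t} 1<t _ (inj₂ t<) → z≁inner (≤-pred 1<t) (≤-pred t<)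
                    ; {suc s} {suc t} s+1<t t≤ _ → chordless (≤-pred s+1<t) (≤-pred t≤) } }
    where open InducedPath path

  module _ (chordal : Chordal H) where

    -- If the last neighbour q i of y on q had i < k, then x y q i … q k would be an induced cycle.
    end-adjacent : ∀ {q k x y} → InducedPath q k → Edge H x y → Edge H y (q 0) → Edge H x (q k) →
                   (∀ {j} → j < k → ¬ Edge H x (q j)) →
                   (∀ {j} → j ≤ k → x ≢ q j) → (∀ {j} → j ≤ k → y ≢ q j) → Edge H y (q k)
    end-adjacent {q} {k} {x} {y} path x~y y~first x~last x≁inner x∉q y∉q
      with greatest (λ j → edge? y (q j)) k y~first
    ... | i , i≤k , y~qi , y≁beyond with m≤n⇒m<n∨m≡n i≤k
    ...   | inj₂ refl = y~qi
    ...   | inj₁ i<k with m≤n⇒∃[o]m+o≡n i<k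
    ...     | m , i+1+m≡k = contradiction (toInducedCycle (close-induced yr x∉yr x~y x~end x≁yr)) (chordal m)
      where
        k≡ : i + suc m ≡ k
        k≡ = trans (+-suc i m) i+1+m≡k

        r : ℕ → Fin n
        r t = q (i + t)

        yr : InducedPath (y ◂ r) (2 + m)
        yr = ◂-induced (drop-induced i (subst (InducedPath q) (sym k≡) path))
               (subst (Edge H y) (cong q (sym (+-identityʳ i))) y~qi)
               (λ 0<t t≤ → y≁beyond (m<m+n i 0<t) (subst (i + _ ≤_) k≡ (+-monoʳ-≤ i t≤)))
               (λ t≤ → y∉q (subst (i + _ ≤_) k≡ (+-monoʳ-≤ i t≤)))

        x∉yr : ∀ {t} → t ≤ 2 + m → x ≢ (y ◂ r) t
        x∉yr {zero}  _  = Edge⇒≢ x~y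
        x∉yr {suc t} t≤ = x∉q (subst (i + t ≤_) k≡ (+-monoʳ-≤ i (≤-pred t≤)))

        x~end : Edge H x (r (suc m))
        x~end = subst (Edge H x) (cong q (sym k≡)) x~last

        x≁yr : ∀ {t} → 0 < t → t < 2 + m → ¬ Edge H x ((y ◂ r) t)
        x≁yr {suc t} _ t< = x≁inner (subst (i + t <_) k≡ (+-monoʳ-< i (≤-pred t<)))

  record InducedPathTo (R : Rel (Fin n) 0ℓ) (T : Pred (Fin n) 0ℓ) (a : Fin n) : Set where
    field
      last      : ℕ
      vertex    : ℕ → Fin n
      induced   : InducedPath vertex last
      starts    : vertex 0 ≡ a
      ends      : T (vertex last)
      avoids    : ∀ {j} → j < last → ¬ T (vertex j)
      reachable : ∀ {j} → j ≤ last → Star R a (vertex j)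

  module _ {R : Rel (Fin n) 0ℓ} (R⇒Edge : ∀ {u v} → R u v → Edge H u v)
           {T : Pred (Fin n) 0ℓ} (T? : Decidable T) where

    inducedPathTo-here : ∀ {a} → T a → InducedPathTo R T a
    inducedPathTo-here {a} ta = record
      { last = 0 ; vertex = λ _ → a ; induced = single-induced _ ; starts = refl
      ; ends = ta ; avoids = λ () ; reachable = λ _ → ε }

    -- a jumps to its last neighbour on the path, which keeps the path induced.
    inducedPathTo-◅ : ∀ {a b} → ¬ T a → R a b → InducedPathTo R T b → InducedPathTo R T a
    inducedPathTo-◅ {a} {b} ¬ta ab p
      with greatest (λ j → edge? a (vertex j)) last (subst (Edge H a) (sym starts) (R⇒Edge ab))
      where open InducedPathTo p
    ... | i , i≤last , a~vi , a≁beyond with m≤n⇒∃[o]m+o≡n i≤last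
    ...   | k , i+k≡last = record
      { last      = suc k
      ; vertex    = a ◂ r
      ; induced   = ◂-induced (drop-induced i (subst (InducedPath vertex) (sym i+k≡last) induced))
                               a~r0 (λ 0<t t≤k → a≁beyond (m<m+n i 0<t) (i+≤last t≤k)) a∉r
      ; starts    = refl
      ; ends      = subst T (cong vertex (sym i+k≡last)) ends
      ; avoids    = λ { {zero} _ → ¬ta ; {suc j} j<k → avoids (subst (i + j <_) i+k≡last (+-monoʳ-< i (≤-pred j<k))) }
      ; reachable = λ { {zero} _ → ε ; {suc j} j≤k → ab ◅ reachable (i+≤last (≤-pred j≤k)) } }
      where
        open InducedPathTo p

        r : ℕ → Fin n
        r t = vertex (i + t)

        i+≤last : ∀ {t} → t ≤ k → i + t ≤ last
        i+≤last t≤k = subst (i + _ ≤_) i+k≡last (+-monoʳ-≤ i t≤k)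

        a~r0 : Edge H a (r 0)
        a~r0 = subst (Edge H a) (cong vertex (sym (+-identityʳ i))) a~vi

        a∉r : ∀ {t} → t ≤ k → a ≢ r t
        a∉r {zero}  _   = Edge⇒≢ a~r0
        a∉r {suc t} t≤k a≡ with m≤n⇒m<n∨m≡n (i+≤last t≤k)
        ... | inj₁ lt   = a≁beyond (s≤s (m≤m+n i (suc t))) lt
                            (subst (λ v → Edge H v (vertex (suc (i + suc t)))) (sym a≡) (linked lt))
          where open InducedPath induced
        ... | inj₂ i+t≡ = ¬ta (subst T (sym (trans a≡ (cong vertex i+t≡))) ends)

    inducedPathTo : ∀ {a z} → Star R a z → T z → InducedPathTo R T a
    inducedPathTo ε         tz = inducedPathTo-here tz
    inducedPathTo {a} (ab ◅ rest) tz with T? a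
    ... | yes ta = inducedPathTo-here ta
    ... | no ¬ta = inducedPathTo-◅ ¬ta ab (inducedPathTo rest tz)

  module Component (S : Pred (Fin n) 0ℓ) (S? : Decidable S) where

    EdgeIn : Rel (Fin n) 0ℓ
    EdgeIn u v = S u × S v × Edge H u v

    Connected : Rel (Fin n) 0ℓ
    Connected = Star EdgeIn

    connected? : Decidable₂ Connected
    connected? = star? λ u v → S? u ×-dec S? v ×-dec edge? u v

    connected-sym : ∀ {u v} → Connected u v → Connected v u
    connected-sym = reverse λ (su , sv , e) → sv , su , Edge-sym e

    connected-S : ∀ {u v} → S u → Connected u v → S v
    connected-S su ε                 = su
    connected-S su ((_ , sv , _) ◅ c) = connected-S sv c

    AttachedTo : Fin n → Fin n → Set
    AttachedTo y p = ∃[ z ] Connected y z × Edge H z p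

    attachedTo? : Decidable₂ AttachedTo
    attachedTo? y p = any? λ z → connected? y z ×-dec edge? z p

    Outside : List (Fin n) → Set
    Outside P = ∀ {p} → p ∈ P → ¬ S p

    AttachedClique : List (Fin n) → Set
    AttachedClique P = ∀ {s s′ p p′} → S s → S s′ → p ∈ P → p′ ∈ P →
                       Edge H s p → Edge H s′ p′ → p ≢ p′ → Edge H p p′

    module _ (chordal : Chordal H) where

      -- If c misses p, the end of an induced path from c to N(p) inside the component is adjacent
      -- to p and, by end-adjacent, to every vertex of P that c was adjacent to.
      complete-vertex : ∀ {y} → S y → ∀ P → Outside P → AttachedClique P →
                        ∃[ c ] Connected y c × (∀ {p} → p ∈ P → AttachedTo y p → Edge H c p)
      complete-vertex {y} sy [] _ _ = y , ε , λ ()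
      complete-vertex {y} sy (p ∷ P) out clique
        with complete-vertex sy P (out ∘ there) (λ s s′ m m′ → clique s s′ (there m) (there m′))
      ... | c , y⇝c , c~P with edge? c p
      ...   | yes c~p = c , y⇝c , λ { (here refl) _ → c~p ; (there m) att → c~P m att }
      ...   | no c≁p with attachedTo? y p
      ...     | no ¬att = c , y⇝c , λ { (here refl) att → contradiction att ¬att ; (there m) att → c~P m att }
      ...     | yes (z , y⇝z , z~p) = vertex last , y⇝c ◅◅ reachable ≤-refl , c′~P
        where
          open InducedPathTo (inducedPathTo (proj₂ ∘ proj₂) (λ v → edge? v p) (connected-sym y⇝c ◅◅ y⇝z) z~p)

          on-path-S : ∀ {j} → j ≤ last → S (vertex j)
          on-path-S j≤ = connected-S (connected-S sy y⇝c) (reachable j≤)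

          c′~P : ∀ {p′} → p′ ∈ p ∷ P → AttachedTo y p′ → Edge H (vertex last) p′
          c′~P (here refl) _ = ends
          c′~P {p′} (there m) att@(z′ , y⇝z′ , z′~p′) = Edge-sym (end-adjacent chordal induced
            (clique (connected-S sy y⇝z) (connected-S sy y⇝z′) (here refl) (there m) z~p z′~p′
                    λ { refl → c≁p (c~P m att) })
            (subst (Edge H p′) (sym starts) (Edge-sym (c~P m att)))
            (Edge-sym ends)
            (λ j< → avoids j< ∘ Edge-sym)
            (λ j≤ p≡ → out (here refl) (subst S (sym p≡) (on-path-S j≤)))
            (λ j≤ p′≡ → out (there m) (subst S (sym p′≡) (on-path-S j≤))))

  -- S: the vertices still to be placed below the current node; P: that node and its ancestors, nearest first.
  module Stage (S : Pred (Fin n) 0ℓ) (S? : Decidable S) (P : List (Fin n)) where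
    open Component S S? public

    CompleteIn : Fin n → Fin n → Set
    CompleteIn y c = Connected y c × All (λ p → AttachedTo y p → Edge H c p) P

    completeIn? : Decidable₂ CompleteIn
    completeIn? y c = connected? y c ×-dec all? (λ p → attachedTo? y p →-dec edge? c p) P

    completeIn-cong : ∀ {y y′ c} → Connected y y′ → CompleteIn y c → CompleteIn y′ c
    completeIn-cong y⇝y′ (y⇝c , c~P) =
      connected-sym y⇝y′ ◅◅ y⇝c ,
      All.map (λ c~p (z , y′⇝z , z~p) → c~p (z , y⇝y′ ◅◅ y′⇝z , z~p)) c~P

    opaque
      representative : Fin n → Maybe (Fin n)
      representative y = find (completeIn? y) (allFin n)

      representative-complete : ∀ {y c} → representative y ≡ just c → CompleteIn y c
      representative-complete = find-sound (completeIn? _) (allFin n)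

      representative-defined : ∀ {y c} → CompleteIn y c → ∃[ c′ ] representative y ≡ just c′
      representative-defined = find-complete (completeIn? _) (∈-allFin _)

      representative-cong : ∀ {y y′} → Connected y y′ → representative y ≡ representative y′
      representative-cong y⇝y′ = find-≐ (completeIn? _) (completeIn? _)
        (completeIn-cong y⇝y′ , completeIn-cong (connected-sym y⇝y′)) (allFin n)

    -- Junk value [] when there is no representative; by representative-exists this never happens for y ∈ S.
    types : Maybe (Fin n) → List AdjType
    types = maybe′ (λ c → map (type H c) P) []

    signature : Fin n → List AdjType
    signature y = types (representative y)

    IsRepresentative : Fin n → Set
    IsRepresentative c = representative c ≡ just c

    Leads : Fin n → Fin n → Set
    Leads x g = S g × signature g ≡ signature x × IsRepresentative g

    leads? : Decidable₂ Leads
    leads? x g = S? g ×-dec ≡-decᴸ _≟ᵗ_ (signature g) (signature x)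
                      ×-dec ≡-decᴹ _≟ᶠ_ (representative g) (just g)

    opaque
      leader : Fin n → Maybe (Fin n)
      leader x = find (leads? x) (allFin n)

      leader-leads : ∀ {x g} → leader x ≡ just g → Leads x g
      leader-leads = find-sound (leads? _) (allFin n)

      leader-defined : ∀ {x g} → Leads x g → ∃[ g′ ] leader x ≡ just g′
      leader-defined = find-complete (leads? _) (∈-allFin _)

      leader-cong : ∀ {x y} → signature y ≡ signature x → leader y ≡ leader x
      leader-cong y≈x = find-≐ (leads? _) (leads? _)
        ((λ (sg , g≈y , rep) → sg , trans g≈y y≈x , rep) , (λ (sg , g≈x , rep) → sg , trans g≈x (sym y≈x) , rep))
        (allFin n)

    signature-cong : ∀ {y y′} → Connected y y′ → signature y ≡ signature y′
    signature-cong y⇝y′ = cong types (representative-cong y⇝y′)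

    representative-idem : ∀ {y c} → representative y ≡ just c → IsRepresentative c
    representative-idem eq = trans (representative-cong (connected-sym (proj₁ (representative-complete eq)))) eq

    signature-types : ∀ {c} → IsRepresentative c → signature c ≡ map (type H c) P
    signature-types isRep = cong types isRep

    leaders-distinguished : ∀ {u v} → leader u ≡ just u → leader v ≡ just v → u ≢ v →
                            ∃[ x ] x ∈ P × type H u x ≢ type H v x
    leaders-distinguished {u} {v} lu lv u≢v = find-∈ (¬All⇒Any¬ (λ x → type H u x ≟ᵗ type H v x) P types-differ)
      where
        types-differ : ¬ All (λ x → type H u x ≡ type H v x) P
        types-differ same = u≢v (just-injective (trans (sym lu) (trans (leader-cong u≈v) lv)))
          where
            u≈v : signature u ≡ signature v
            u≈v = trans (signature-types (proj₂ (proj₂ (leader-leads lu))))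
                   (trans (map-cong-local same) (sym (signature-types (proj₂ (proj₂ (leader-leads lv))))))

    Below : Fin n → Fin n → Set
    Below g y = S y × signature y ≡ signature g × y ≢ g

    below? : ∀ g → Decidable (Below g)
    below? g y = S? y ×-dec ≡-decᴸ _≟ᵗ_ (signature y) (signature g) ×-dec ¬? (y ≟ᶠ g)

    module _ (chordal : Chordal H) (outside : Outside P) (attached-clique : AttachedClique P) where

      representative-exists : ∀ {y} → S y → ∃[ c ] representative y ≡ just c
      representative-exists sy with complete-vertex chordal sy P outside attached-clique
      ... | c , y⇝c , c~P = representative-defined (y⇝c , All.tabulate c~P)

      leader-exists : ∀ {x} → S x → ∃[ g ] leader x ≡ just g
      leader-exists sx with representative-exists sx
      ... | c , eq = leader-defined
        (connected-S sx (proj₁ (representative-complete eq)) ,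
         cong types (trans (representative-idem eq) (sym eq)) ,
         representative-idem eq)

      representative-adjacent : ∀ {g s p} → IsRepresentative g → S s → signature s ≡ signature g →
                                p ∈ P → Edge H s p → Edge H g p
      representative-adjacent {g} {s} {p} isRep ss s≈g p∈P s~p with representative-exists ss
      ... | r , eq = λ g≁p → r~p (trans same-type g≁p)
        where
          r~p : Edge H r p
          r~p = All.lookup (proj₂ (representative-complete eq)) p∈P (s , ε , s~p)

          same-type : type H r p ≡ type H g p
          same-type = map-≡-∈ P (trans (cong types (sym eq)) (trans s≈g (signature-types isRep))) p∈P

  module Construction (chordal : Chordal H) where

    mutual
      Remaining : List (Fin n) → Pred (Fin n) 0ℓ
      Remaining []      y = ⊤
      Remaining (g ∷ P) y = Stage.Below (Remaining P) (remaining? P) P g y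

      remaining? : ∀ P → Decidable (Remaining P)
      remaining? []      y = yes tt
      remaining? (g ∷ P) y = Stage.below? (Remaining P) (remaining? P) P g y

    module StageAt (P : List (Fin n)) = Stage (Remaining P) (remaining? P) P

    IsLeader : List (Fin n) → Fin n → Set
    IsLeader P g = StageAt.leader P g ≡ just g

    data Valid : List (Fin n) → Set where
      []  : Valid []
      _∷_ : ∀ {P g} → IsLeader P g → Valid P → Valid (g ∷ P)

    record Invariant (P : List (Fin n)) : Set where
      open StageAt P using (Outside; AttachedClique)
      field
        outside         : Outside P
        closed          : ∀ {s w} → Remaining P s → Edge H s w → Remaining P w ⊎ w ∈ P
        attached-clique : AttachedClique P

    leader-remaining : ∀ {P g} → IsLeader P g → Remaining P g
    leader-remaining lg = proj₁ (StageAt.leader-leads _ lg)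

    parent-adjacent : ∀ {P g s p} → Invariant P → IsLeader P g → Remaining (g ∷ P) s →
                      p ∈ P → Edge H s p → Edge H g p
    parent-adjacent {P} inv lg (rs , s≈g , _) =
      representative-adjacent chordal outside attached-clique (proj₂ (proj₂ (leader-leads lg))) rs s≈g
      where
        open Invariant inv
        open StageAt P

    invariant : ∀ {P} → Valid P → Invariant P
    invariant [] = record { outside = λ () ; closed = λ _ _ → inj₁ tt ; attached-clique = λ _ _ () }
    invariant {g ∷ P} (lg ∷ vP) = record
      { outside         = outside′
      ; closed          = closed′
      ; attached-clique = clique′ }
      where
        open Invariant (invariant vP)
        open StageAt P

        g~ : ∀ {s p} → Remaining (g ∷ P) s → p ∈ P → Edge H s p → Edge H g p
        g~ = parent-adjacent (invariant vP) lg

        outside′ : ∀ {p} → p ∈ g ∷ P → ¬ Remaining (g ∷ P) p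
        outside′ (here refl) (_ , _ , g≢g) = g≢g refl
        outside′ (there p∈P) (rp , _)      = outside p∈P rp

        closed′ : ∀ {s w} → Remaining (g ∷ P) s → Edge H s w → Remaining (g ∷ P) w ⊎ w ∈ g ∷ P
        closed′ {s} {w} (rs , s≈g , _) s~w with closed rs s~w | w ≟ᶠ g
        ... | inj₂ w∈P | _        = inj₂ (there w∈P)
        ... | inj₁ _   | yes refl = inj₂ (here refl)
        ... | inj₁ rw  | no w≢g   = inj₁ (rw , trans (signature-cong ((rw , rs , Edge-sym s~w) ◅ ε)) s≈g , w≢g)

        clique′ : StageAt.AttachedClique (g ∷ P) (g ∷ P)
        clique′ rs rs′ (here refl) (here refl) _ _  p≢p′ = contradiction refl p≢p′
        clique′ rs rs′ (here refl) (there m′)  _ e′ _    = g~ rs′ m′ e′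
        clique′ rs rs′ (there m)   (here refl) e _  _    = Edge-sym (g~ rs m e)
        clique′ rs rs′ (there m)   (there m′)  e e′ p≢p′ = attached-clique (proj₁ rs) (proj₁ rs′) m m′ e e′ p≢p′

    remaining-count : List (Fin n) → ℕ
    remaining-count P = length (filter (remaining? P) (allFin n))

    length+remaining≤n : ∀ {P} → Valid P → length P + remaining-count P ≤ n
    length+remaining≤n [] = length-filter-allFin (remaining? [])
    length+remaining≤n {g ∷ P} (lg ∷ vP) = begin
      suc (length P) + remaining-count (g ∷ P) ≡⟨ sym (+-suc (length P) _) ⟩
      length P + suc (remaining-count (g ∷ P)) ≤⟨ +-monoʳ-≤ (length P) fewer ⟩
      length P + remaining-count P             ≤⟨ length+remaining≤n vP ⟩
      n                                        ∎
      where
        open ≤-Reasoning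
        fewer : remaining-count (g ∷ P) < remaining-count P
        fewer = length-filter-⊂ (remaining? P) (remaining? (g ∷ P)) proj₁ (∈-allFin g)
                  (leader-remaining lg) (λ (_ , _ , g≢g) → g≢g refl)

    length<n : ∀ {P y} → Valid P → Remaining P y → length P < n
    length<n {P} vP ry = ≤-trans (m<m+n (length P) (filter-some (remaining? P) (lose (∈-allFin _) ry)))
                                 (length+remaining≤n vP)

    spare-fuel : ∀ {P y} → Valid P → Remaining P y → ∃[ f ] suc f + length P ≡ n
    spare-fuel {P} vP ry with m≤n⇒∃[o]m+o≡n (length<n vP ry)
    ... | f , eq = f , trans (cong suc (+-comm f (length P))) eq

    below⇒leader : ∀ {P g y} → IsLeader P g → Remaining (g ∷ P) y → StageAt.leader P y ≡ just g
    below⇒leader {P} lg (_ , y≈g , _) = trans (StageAt.leader-cong P y≈g) lg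

    leader⇒below : ∀ {P g y} → Remaining P y → StageAt.leader P y ≡ just g → g ≢ y →
                   IsLeader P g × Remaining (g ∷ P) y
    leader⇒below {P} ry ly g≢y = trans (StageAt.leader-cong P g≈y) ly , ry , sym g≈y , g≢y ∘ sym
      where g≈y = proj₁ (proj₂ (StageAt.leader-leads P ly))

    -- path y lists y and its ancestors, nearest first. Every step places one more vertex, so the fuel n
    -- never runs out (length+remaining≤n).
    descend : ℕ → List (Fin n) → Fin n → List (Fin n)
    descend zero    P y = P
    descend (suc f) P y with remaining? P y
    ... | no  _ = P
    ... | yes _ = maybe′ (λ g → descend f (g ∷ P) y) P (StageAt.leader P y)

    path : Fin n → List (Fin n)
    path y = descend n [] y

    parent : Fin n → Maybe (Fin n)
    parent y = head (drop 1 (path y))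

    descend-stop : ∀ f {P y} → ¬ Remaining P y → descend f P y ≡ P
    descend-stop zero    ¬ry = refl
    descend-stop (suc f) {P} {y} ¬ry with remaining? P y
    ... | no  _  = refl
    ... | yes ry = contradiction ry ¬ry

    descend-step : ∀ f {P y g} → Remaining P y → StageAt.leader P y ≡ just g →
                   descend (suc f) P y ≡ descend f (g ∷ P) y
    descend-step f {P} {y} ry eq with remaining? P y
    ... | no ¬ry = contradiction ry ¬ry
    ... | yes _  = cong (maybe′ (λ g → descend f (g ∷ P) y) P) eq

    descend-⊇ : ∀ f P y {a} → a ∈ P → a ∈ descend f P y
    descend-⊇ zero    P y a∈P = a∈P
    descend-⊇ (suc f) P y a∈P with remaining? P y
    ... | no  _ = a∈P
    ... | yes _ with StageAt.leader P y
    ...   | nothing = a∈P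
    ...   | just g  = descend-⊇ f (g ∷ P) y (there a∈P)

    path-through : ∀ {P y} → Valid P → Remaining P y → ∀ f → f + length P ≡ n → path y ≡ descend f P y
    path-through {y = y} [] _ f eq = cong (λ k → descend k [] y) (sym (trans (sym (+-identityʳ f)) eq))
    path-through {g ∷ P} (lg ∷ vP) ry@(ry′ , _) f eq = trans
      (path-through vP ry′ (suc f) (trans (sym (+-suc f (length P))) eq))
      (descend-step f ry′ (below⇒leader lg ry))

    path-valid : ∀ {P g} → Valid (g ∷ P) → path g ≡ g ∷ P
    path-valid {P} {g} (lg ∷ vP) with spare-fuel vP (leader-remaining lg)
    ... | f , eq = trans (path-through vP (leader-remaining lg) (suc f) eq)
                     (trans (descend-step f (leader-remaining lg) lg)
                            (descend-stop f λ (_ , _ , g≢g) → g≢g refl))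

    descend-birth : ∀ f {P y} → Valid P → Remaining P y → f + length P ≡ n →
                    ∃[ B ] Valid (y ∷ B) × descend f P y ≡ y ∷ B
    descend-birth zero vP ry eq = contradiction eq (<⇒≢ (length<n vP ry))
    descend-birth (suc f) {P} {y} vP ry eq
      with StageAt.leader-exists P chordal outside attached-clique ry
      where open Invariant (invariant vP)
    ... | g , ly with g ≟ᶠ y
    ...   | yes refl = P , ly ∷ vP , trans (descend-step f ry ly) (descend-stop f λ (_ , _ , y≢y) → y≢y refl)
    ...   | no g≢y with leader⇒below ry ly g≢y
    ...     | lg , ry′ with descend-birth f (lg ∷ vP) ry′ (trans (+-suc f (length P)) eq)
    ...       | B , vyB , descend≡ = B , vyB , trans (descend-step f ry ly) descend≡

    path-form : ∀ y → ∃[ B ] Valid (y ∷ B) × path y ≡ y ∷ B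
    path-form y = descend-birth n [] tt (+-identityʳ n)

    ∈-path : ∀ {P v w} → Valid (v ∷ P) → Remaining (v ∷ P) w → v ∈ path w
    ∈-path {P} {v} {w} vvP rw with spare-fuel vvP rw
    ... | f , eq = subst (v ∈_) (sym (path-through vvP rw (suc f) eq)) (descend-⊇ (suc f) (v ∷ P) w (here refl))

    parent-valid : ∀ {B v} → Valid (v ∷ B) → parent v ≡ head B
    parent-valid vvB = cong (head ∘ drop 1) (path-valid vvB)

    placement : ∀ {v q} → parent v ≡ just q → ∃[ B ] Valid (v ∷ q ∷ B)
    placement {v} pv with path-form v
    ... | [] , vv , _ = contradiction (trans (sym pv) (parent-valid vv)) λ ()
    ... | q ∷ B , vv , _ with just-injective (trans (sym (parent-valid vv)) pv)
    ...   | refl = B , vv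

    ancestor⇒∈ : ∀ {u v} → Ancestor parent u v → u ∈ path v
    ancestor⇒∈ {v = v} here with path-form v
    ... | B , _ , eq = subst (v ∈_) (sym eq) (here refl)
    ancestor⇒∈ {u} {v} (up pv anc) with placement pv
    ... | B , vv@(_ ∷ vqB) = subst (u ∈_) (sym (path-valid vv)) (there (subst (u ∈_) (path-valid vqB) (ancestor⇒∈ anc)))

    ∈⇒ancestor : ∀ {B u v} → Valid (v ∷ B) → u ∈ v ∷ B → Ancestor parent u v
    ∈⇒ancestor _                      (here refl) = here
    ∈⇒ancestor {q ∷ B} vv@(_ ∷ vqB) (there u∈)  = up (parent-valid vv) (∈⇒ancestor vqB u∈)

    ∈path⇒ancestor : ∀ {u v} → u ∈ path v → Ancestor parent u v
    ∈path⇒ancestor {u} {v} u∈ with path-form v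
    ... | B , vv , eq = ∈⇒ancestor vv (subst (u ∈_) eq u∈)

    root-leader : ∀ {r} → parent r ≡ nothing → IsLeader [] r
    root-leader {r} pr with path-form r
    ... | []    , lr ∷ [] , _ = lr
    ... | q ∷ B , vv      , _ = contradiction (trans (sym (parent-valid vv)) pr) λ ()

    root-unique : ∀ r s → parent r ≡ nothing → parent s ≡ nothing → r ≡ s
    root-unique r s pr ps with r ≟ᶠ s
    ... | yes r≡s = r≡s
    ... | no  r≢s with StageAt.leaders-distinguished [] (root-leader pr) (root-leader ps) r≢s
    ...   | _ , () , _

    reach-root : ∀ v → ∃[ r ] parent r ≡ nothing × Ancestor parent r v
    reach-root v = reach (proj₁ (proj₂ (path-form v)))
      where
        reach : ∀ {B v} → Valid (v ∷ B) → ∃[ r ] parent r ≡ nothing × Ancestor parent r v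
        reach {[]}    {v} vv           = v , parent-valid vv , here
        reach {q ∷ B}     vv@(_ ∷ vqB) with reach vqB
        ... | r , pr , anc = r , pr , up (parent-valid vv) anc

    ancestors-clique : ∀ v a b → Ancestor parent a v → Ancestor parent b v →
                       Edge H v a → Edge H v b → a ≢ b → Edge H a b
    ancestors-clique v a b av bv v~a v~b a≢b with path-form v
    ... | B , vv@(lv ∷ vB) , eq = attached-clique (leader-remaining lv) (leader-remaining lv)
                                    (proper av v~a) (proper bv v~b) v~a v~b a≢b
      where
        open Invariant (invariant vB)
        proper : ∀ {u} → Ancestor parent u v → Edge H v u → u ∈ B
        proper uv v~u with subst (_ ∈_) eq (ancestor⇒∈ uv)
        ... | here refl = contradiction v~u Edge-irrefl
        ... | there u∈B = u∈B

    neighbours-placed : ∀ v q → parent v ≡ just q → ∀ w → Edge H v w →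
                        Ancestor parent v w ⊎ (Ancestor parent w v × (w ≡ q ⊎ Edge H q w))
    neighbours-placed v q pv w v~w with placement pv
    ... | B , vv@(lv ∷ vqB@(lq ∷ vB)) with Invariant.closed (invariant vqB) (leader-remaining lv) v~w
    ...   | inj₂ w∈qB = inj₂ (∈⇒ancestor vv (there w∈qB) , attach w∈qB)
      where
        attach : w ∈ q ∷ B → w ≡ q ⊎ Edge H q w
        attach (here refl) = inj₁ refl
        attach (there w∈B) = inj₂ (parent-adjacent (invariant vB) lq (leader-remaining lv) w∈B v~w)
    ...   | inj₁ rw = inj₁ (∈path⇒ancestor (∈-path vv (rw , w≈v , Edge⇒≢ v~w ∘ sym)))
      where
        w≈v = StageAt.signature-cong (q ∷ B) ((rw , leader-remaining lv , Edge-sym v~w) ◅ ε)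

    siblings-distinguished : ∀ u v q → u ≢ v → parent u ≡ just q → parent v ≡ just q →
                             ∃[ x ] Ancestor parent x u × Ancestor parent x v × type H u x ≢ type H v x
    siblings-distinguished u v q u≢v pu pv with placement pu | placement pv
    ... | Bu , vu@(lu ∷ vqBu) | Bv , vv@(lv ∷ vqBv)
      with ∷-injectiveʳ (trans (sym (path-valid vqBu)) (path-valid vqBv))
    ...   | refl with StageAt.leaders-distinguished (q ∷ Bu) lu lv u≢v
    ...     | x , x∈ , types≢ = x , ∈⇒ancestor vu (there x∈) , ∈⇒ancestor vv (there x∈) , types≢

    tree-representation : TreeRepresentation H
    tree-representation = record
      { parent = parent
      ; isTree = record { rootUnique = root-unique ; reachRoot = reach-root }
      ; cond1  = ancestors-clique
      ; cond2  = neighbours-placed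
      ; cond3  = siblings-distinguished }

lemma3p1 : (n : ℕ) (H : Trigraph n) → Chordal H → TreeRepresentation H
lemma3p1 n H chordal = Construction.tree-representation H chordal
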